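{- For every integer $n\ge0$ and generic $a,k$, \[ {}_6W_5\left(\frac{a k}{q};\frac{a q}{k},k^2q^{2n},q^{ -2n};q^2,1\right)=\frac{\left(k/a,-q;q\right)_n}{\left(-k,a q;q\right)_n} \frac{(a k q;q^2)_n}{(k q/a;q^2)_n}\; {}_{6}W_5 \left(a;\frac{a q}{k}, k q^{n},q^{ -n};q,1 \right). \]
   Context: $(x;p)_n=\prod_{i=0}^{n-1}(1-xp^i)$, $(x_1,\dots,x_m;p)_n=\prod_i(x_i;p)_n$. The very-well-poised series is ${}_{r+1}W_r(A;b_1,\dots,b_{r-2};p,z)=\sum_{m\ge0}\frac{1-Ap^{2m}}{1-A}\frac{(A,b_1,\dots,b_{r-2};p)_m}{(p,Ap/b_1,\dots,Ap/b_{r-2};p)_m}z^m$. -}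

module Defs where

open import Data.Nat using (ℕ; zero; suc; _≤_)
open import Data.Rational using (ℚ; 0ℚ; 1ℚ; _+_; _*_; _-_; -_; 1/_; ≢-nonZero; _≟_)
open import Data.Product using (_×_)
open import Relation.Binary.PropositionalEquality using (_≡_; _≢_)
open import Relation.Nullary using (yes; no)

-- total inverse on ℚ (value 0 at 0); only ever used at nonzero
-- arguments, which the hypotheses of the theorem guarantee
inv : ℚ → ℚ
inv p with p ≟ 0ℚ
... | yes _ = 0ℚ
... | no ne = 1/_ p {{≢-nonZero ne}}

infixl 7 _/'_
_/'_ : ℚ → ℚ → ℚ
x /' y = x * inv y

infixr 8 _^_
_^_ : ℚ → ℕ → ℚ
x ^ zero = 1ℚ
x ^ suc n = x * (x ^ n)

poch : ℚ → ℚ → ℕ → ℚ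
poch x p zero = 1ℚ
poch x p (suc n) = poch x p n * (1ℚ - x * p ^ n)

W6term : ℚ → ℚ → ℚ → ℚ → ℚ → ℚ → ℕ → ℚ
W6term A b1 b2 b3 p z m =
  ((1ℚ - A * p ^ (2 Data.Nat.* m)) /' (1ℚ - A))
  * ((poch A p m * poch b1 p m * poch b2 p m * poch b3 p m)
     /' (poch p p m * poch (A * p /' b1) p m * poch (A * p /' b2) p m * poch (A * p /' b3) p m))
  * z ^ m

W6 : ℚ → ℚ → ℚ → ℚ → ℚ → ℚ → ℕ → ℚ
W6 A b1 b2 b3 p z zero = W6term A b1 b2 b3 p z zero
W6 A b1 b2 b3 p z (suc N) = W6 A b1 b2 b3 p z N + W6term A b1 b2 b3 p z (suc N)

W6ok : ℚ → ℚ → ℚ → ℚ → ℚ → ℕ → Set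
W6ok A b1 b2 b3 p N =
  (1ℚ - A ≢ 0ℚ) × (b1 ≢ 0ℚ) × (b2 ≢ 0ℚ) × (b3 ≢ 0ℚ) ×
  (∀ m → m ≤ N →
     (poch p p m ≢ 0ℚ) × (poch (A * p /' b1) p m ≢ 0ℚ) ×
     (poch (A * p /' b2) p m ≢ 0ℚ) × (poch (A * p /' b3) p m ≢ 0ℚ))

{-# OPTIONS --safe #-}
module Submission where

-- Both series are evaluated by Jackson's terminating 6W5 summation, used in the form
--   6W5(a; aq/k, kq^n, q^-n; q, 1) · (k;q)_n ∏_{i<n} (a − k q^i) · q^n = (aq;q)_n (q;q)_n k^n,
-- once as it stands and once with (a, k, q) replaced by (ak/q, k², q²).  Dividing the two
-- evaluations, with (z²;q²)_n = (z;q)_n (−z;q)_n, gives exactly the stated factor.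
--
-- Jackson's summation is proved by the WZ method.  With x = q^n, the sum S_n of the terms
-- multiplied by (1 − a)(aqx;q)_n satisfies μ_n S_{n+1} = ν_n S_n, where μ_n and ν_n are the
-- ratios of consecutive values of the normalising factor and of the closed form.  The recurrence
-- holds because, termwise, the difference of the two sides is the forward difference in m of an
-- explicit certificate; after dividing out the factors common to the four terms, each termwise
-- identity is a polynomial identity in a, k, q, x and y = q^m.

open import Defs
open import Data.Nat using (ℕ; zero; suc; _≤_; _<_; z≤n; s≤s; _∸_)
import Data.Nat as ℕ
import Data.Nat.Properties as ℕ
open import Data.Rational using (ℚ; 0ℚ; 1ℚ; _+_; _*_; _-_; -_; ≢-nonZero; _≟_)
open import Data.Rational.Properties
  using (+-*-commutativeRing; heytingCommutativeRing; *-inverseʳ; *-comm; *-assoc; *-identityˡ; *-identityʳ; *-zeroˡ; *-zeroʳ; 1≢0)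
open import Algebra.Apartness.Properties.HeytingCommutativeRing heytingCommutativeRing
  using (x#0y#0→xy#0)
open import Data.Maybe.Base using (Maybe; just; nothing)
open import Data.Product using (_,_; proj₁; proj₂)
open import Data.Sum using (_⊎_; inj₁; inj₂)
open import Relation.Binary.PropositionalEquality
  using (_≡_; _≢_; refl; sym; trans; cong; cong₂; subst; subst₂; module ≡-Reasoning)
open import Relation.Nullary using (yes; no; contradiction)
open import Tactic.RingSolver using (solve-∀)
open import Tactic.RingSolver.Core.AlmostCommutativeRing using (AlmostCommutativeRing; fromCommutativeRing)

ℚ-ring : AlmostCommutativeRing _ _
ℚ-ring = fromCommutativeRing +-*-commutativeRing 0≟
  where
  0≟ : ∀ p → Maybe (0ℚ ≡ p)
  0≟ p with 0ℚ ≟ p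
  ... | yes 0≡p = just 0≡p
  ... | no _    = nothing

cong₃ : ∀ (f : ℚ → ℚ → ℚ → ℚ) {u u′ v v′ w w′} → u ≡ u′ → v ≡ v′ → w ≡ w′ → f u v w ≡ f u′ v′ w′
cong₃ f refl refl refl = refl

*-≢0 : ∀ {p r} → p ≢ 0ℚ → r ≢ 0ℚ → p * r ≢ 0ℚ
*-≢0 = x#0y#0→xy#0

p*inv[p]≡1 : ∀ {p} → p ≢ 0ℚ → p * inv p ≡ 1ℚ
p*inv[p]≡1 {p} p≢0 with p ≟ 0ℚ
... | yes p≡0 = contradiction p≡0 p≢0
... | no p≢0′ = *-inverseʳ p {{≢-nonZero p≢0′}}

-- Case analysis through this, not `with p ≟ 0ℚ`: the latter would also abstract the test
-- hidden inside `inv p` and get stuck.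
≡0⊎≢0 : ∀ p → p ≡ 0ℚ ⊎ p ≢ 0ℚ
≡0⊎≢0 p with p ≟ 0ℚ
... | yes p≡0 = inj₁ p≡0
... | no p≢0  = inj₂ p≢0

*≡1⇒≢0 : ∀ {p r} → p * r ≡ 1ℚ → p ≢ 0ℚ
*≡1⇒≢0 {r = r} pr≡1 refl = 1≢0 (trans (sym pr≡1) (*-zeroˡ r))

x*inv[y]*y≡x : ∀ x {y} → y ≢ 0ℚ → x * inv y * y ≡ x
x*inv[y]*y≡x x {y} y≢0 = begin
  x * inv y * y     ≡⟨ *-assoc x (inv y) y ⟩
  x * (inv y * y)   ≡⟨ cong (x *_) (trans (*-comm (inv y) y) (p*inv[p]≡1 y≢0)) ⟩
  x * 1ℚ            ≡⟨ *-identityʳ x ⟩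
  x                 ∎
  where open ≡-Reasoning

*-cancelʳ-≡ : ∀ r s {d} → d ≢ 0ℚ → r * d ≡ s * d → r ≡ s
*-cancelʳ-≡ r s {d} d≢0 rd≡sd = begin
  r                ≡⟨ sym (x*inv[y]*y≡x r d≢0) ⟩
  r * inv d * d    ≡⟨ swap r (inv d) d ⟩
  r * d * inv d    ≡⟨ cong (_* inv d) rd≡sd ⟩
  s * d * inv d    ≡⟨ swap s d (inv d) ⟩
  s * inv d * d    ≡⟨ x*inv[y]*y≡x s d≢0 ⟩
  s                ∎
  where
  open ≡-Reasoning
  swap : ∀ u v w → u * v * w ≡ u * w * v
  swap = solve-∀ ℚ-ring

*-cancelˡ-≡ : ∀ r s {d} → d ≢ 0ℚ → d * r ≡ d * s → r ≡ s
*-cancelˡ-≡ r s {d} d≢0 dr≡ds = *-cancelʳ-≡ r s d≢0 (trans (*-comm r d) (trans dr≡ds (*-comm d s)))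

inv-unique : ∀ p r → p * r ≡ 1ℚ → r ≡ inv p
inv-unique p r pr≡1 = *-cancelˡ-≡ r (inv p) p≢0 (trans pr≡1 (sym (p*inv[p]≡1 p≢0)))
  where
  p≢0 : p ≢ 0ℚ
  p≢0 = *≡1⇒≢0 {p} {r} pr≡1

inv-distrib-* : ∀ p r → inv (p * r) ≡ inv p * inv r
inv-distrib-* p r with ≡0⊎≢0 p | ≡0⊎≢0 r
... | inj₁ refl | _        = trans (cong inv (*-zeroˡ r)) (sym (*-zeroˡ (inv r)))
... | inj₂ _    | inj₁ refl = trans (cong inv (*-zeroʳ p)) (sym (*-zeroʳ (inv p)))
... | inj₂ p≢0  | inj₂ r≢0 = sym (inv-unique (p * r) (inv p * inv r) (begin
  p * r * (inv p * inv r)        ≡⟨ swap p r (inv p) (inv r) ⟩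
  (p * inv p) * (r * inv r)      ≡⟨ cong₂ _*_ (p*inv[p]≡1 p≢0) (p*inv[p]≡1 r≢0) ⟩
  1ℚ                             ∎))
  where
  open ≡-Reasoning
  swap : ∀ u v w z → u * v * (w * z) ≡ (u * w) * (v * z)
  swap = solve-∀ ℚ-ring

inv-involutive : ∀ p → inv (inv p) ≡ p
inv-involutive p with ≡0⊎≢0 p
... | inj₁ refl = refl
... | inj₂ p≢0  = sym (inv-unique (inv p) p (trans (*-comm (inv p) p) (p*inv[p]≡1 p≢0)))

inv-solve : ∀ u s c v → u * s ≡ c * v → c ≢ 0ℚ → inv v ≡ inv u * inv s * c
inv-solve u s c v us≡cv c≢0 = begin
  inv v                       ≡⟨ cong inv v≡us/c ⟩
  inv (u * s * inv c)         ≡⟨ inv-distrib-* (u * s) (inv c) ⟩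
  inv (u * s) * inv (inv c)   ≡⟨ cong₂ _*_ (inv-distrib-* u s) (inv-involutive c) ⟩
  inv u * inv s * c           ∎
  where
  open ≡-Reasoning
  v≡us/c : v ≡ u * s * inv c
  v≡us/c = *-cancelʳ-≡ v (u * s * inv c) c≢0
             (trans (*-comm v c) (trans (sym us≡cv) (sym (x*inv[y]*y≡x (u * s) c≢0))))

^-distribˡ-+-* : ∀ p m n → p ^ (m ℕ.+ n) ≡ p ^ m * p ^ n
^-distribˡ-+-* p zero    n = sym (*-identityˡ (p ^ n))
^-distribˡ-+-* p (suc m) n = trans (cong (p *_) (^-distribˡ-+-* p m n)) (sym (*-assoc p (p ^ m) (p ^ n)))

^-distribʳ-* : ∀ p r n → (p * r) ^ n ≡ p ^ n * r ^ n
^-distribʳ-* p r zero    = refl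
^-distribʳ-* p r (suc n) = trans (cong ((p * r) *_) (^-distribʳ-* p r n)) (swap p r (p ^ n) (r ^ n))
  where
  swap : ∀ u v w z → u * v * (w * z) ≡ (u * w) * (v * z)
  swap = solve-∀ ℚ-ring

^-≢0 : ∀ {p} n → p ≢ 0ℚ → p ^ n ≢ 0ℚ
^-≢0 zero    p≢0 = 1≢0
^-≢0 (suc n) p≢0 = *-≢0 p≢0 (^-≢0 n p≢0)

1^n≡1 : ∀ n → 1ℚ ^ n ≡ 1ℚ
1^n≡1 zero    = refl
1^n≡1 (suc n) = trans (*-identityˡ (1ℚ ^ n)) (1^n≡1 n)

inv-^ : ∀ p n → inv (p ^ n) ≡ inv p ^ n
inv-^ p zero    = refl
inv-^ p (suc n) = trans (inv-distrib-* p (p ^ n)) (cong (inv p *_) (inv-^ p n))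

Π : (ℕ → ℚ) → ℕ → ℚ
Π f zero    = 1ℚ
Π f (suc m) = Π f m * f m

Πfrom : (ℕ → ℚ) → ℕ → ℕ → ℚ
Πfrom f s = Π (λ i → f (s ℕ.+ i))

Π-cong : ∀ {f g} m → (∀ i → f i ≡ g i) → Π f m ≡ Π g m
Π-cong zero    f≗g = refl
Π-cong (suc m) f≗g = cong₂ _*_ (Π-cong m f≗g) (f≗g m)

Π-suc : ∀ f m → Π f (suc m) ≡ f 0 * Π (λ i → f (suc i)) m
Π-suc f zero    = *-comm 1ℚ (f 0)
Π-suc f (suc m) = trans (cong (_* f (suc m)) (Π-suc f m)) (*-assoc (f 0) _ (f (suc m)))

Π-const-* : ∀ c f m → Π (λ i → c * f i) m ≡ c ^ m * Π f m
Π-const-* c f zero    = sym (*-identityˡ 1ℚ)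
Π-const-* c f (suc m) = trans (cong (_* (c * f m)) (Π-const-* c f m)) (shuffle c (c ^ m) (Π f m) (f m))
  where
  shuffle : ∀ c u v w → u * v * (c * w) ≡ c * u * (v * w)
  shuffle = solve-∀ ℚ-ring

Π-+ : ∀ f m l → Π f (m ℕ.+ l) ≡ Π f m * Πfrom f m l
Π-+ f m zero    = trans (cong (Π f) (ℕ.+-identityʳ m)) (sym (*-identityʳ (Π f m)))
Π-+ f m (suc l) = trans (cong (Π f) (ℕ.+-suc m l))
  (trans (cong (_* f (m ℕ.+ l)) (Π-+ f m l)) (*-assoc (Π f m) (Πfrom f m l) (f (m ℕ.+ l))))

Πfrom-suc : ∀ f s l → Πfrom f s (suc l) ≡ f s * Πfrom f (suc s) l
Πfrom-suc f s l = trans (Π-suc (λ i → f (s ℕ.+ i)) l)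
  (cong₂ _*_ (cong f (ℕ.+-identityʳ s)) (Π-cong l (λ i → cong f (ℕ.+-suc s i))))

Π≢0⇒factor≢0 : ∀ f m → Π f m ≢ 0ℚ → ∀ i → i < m → f i ≢ 0ℚ
Π≢0⇒factor≢0 f (suc m) Π≢0 i i<1+m with ℕ.m≤n⇒m<n∨m≡n (ℕ.≤-pred i<1+m)
... | inj₁ i<m  = Π≢0⇒factor≢0 f m (λ Π≡0 → Π≢0 (trans (cong (_* f m) Π≡0) (*-zeroˡ (f m)))) i i<m
... | inj₂ refl = λ fm≡0 → Π≢0 (trans (cong (Π f m *_) fm≡0) (*-zeroʳ (Π f m)))

sum≤ : (ℕ → ℚ) → ℕ → ℚ
sum≤ f zero    = f 0
sum≤ f (suc N) = sum≤ f N + f (suc N)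

sum≤-cong : ∀ {f g} N → (∀ m → m ≤ N → f m ≡ g m) → sum≤ f N ≡ sum≤ g N
sum≤-cong zero    f≗g = f≗g 0 z≤n
sum≤-cong (suc N) f≗g = cong₂ _+_ (sum≤-cong N (λ m m≤N → f≗g m (ℕ.m≤n⇒m≤1+n m≤N))) (f≗g (suc N) ℕ.≤-refl)

sum≤-const-* : ∀ c f N → sum≤ (λ m → c * f m) N ≡ c * sum≤ f N
sum≤-const-* c f zero    = refl
sum≤-const-* c f (suc N) = trans (cong (_+ c * f (suc N)) (sum≤-const-* c f N)) (distrib c (sum≤ f N) (f (suc N)))
  where
  distrib : ∀ c u v → c * u + c * v ≡ c * (u + v)
  distrib = solve-∀ ℚ-ring

W6≡sum≤ : ∀ A b₁ b₂ b₃ p z N → W6 A b₁ b₂ b₃ p z N ≡ sum≤ (W6term A b₁ b₂ b₃ p z) N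
W6≡sum≤ A b₁ b₂ b₃ p z zero    = refl
W6≡sum≤ A b₁ b₂ b₃ p z (suc N) = cong (_+ W6term A b₁ b₂ b₃ p z (suc N)) (W6≡sum≤ A b₁ b₂ b₃ p z N)

telescope : ∀ (u v h : ℕ → ℚ) n →
  (∀ m → m ≤ n → u m ≡ v m + (h (suc m) - h m)) → u (suc n) ≡ - h (suc n) → h 0 ≡ 0ℚ →
  sum≤ u (suc n) ≡ sum≤ v n
telescope u v h n step last h0≡0 = begin
  sum≤ u n + u (suc n)                                   ≡⟨ cong₂ _+_ (partial n step) last ⟩
  (sum≤ v n + (h (suc n) - h 0)) + - h (suc n)           ≡⟨ cong (λ z → (sum≤ v n + (h (suc n) - z)) + - h (suc n)) h0≡0 ⟩
  (sum≤ v n + (h (suc n) - 0ℚ)) + - h (suc n)            ≡⟨ cancel (sum≤ v n) (h (suc n)) ⟩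
  sum≤ v n                                               ∎
  where
  open ≡-Reasoning
  cancel : ∀ s t → (s + (t - 0ℚ)) + - t ≡ s
  cancel = solve-∀ ℚ-ring
  regroup : ∀ s w h₀ h₁ h₂ → (s + (h₁ - h₀)) + (w + (h₂ - h₁)) ≡ (s + w) + (h₂ - h₀)
  regroup = solve-∀ ℚ-ring
  partial : ∀ N → (∀ m → m ≤ N → u m ≡ v m + (h (suc m) - h m)) → sum≤ u N ≡ sum≤ v N + (h (suc N) - h 0)
  partial zero    step = step 0 z≤n
  partial (suc N) step = trans
    (cong₂ _+_ (partial N (λ m m≤N → step m (ℕ.m≤n⇒m≤1+n m≤N))) (step (suc N) ℕ.≤-refl))
    (regroup (sum≤ v N) (v (suc N)) (h 0) (h (suc N)) (h (suc (suc N))))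

poch≡Π : ∀ z p m → poch z p m ≡ Π (λ i → 1ℚ - z * p ^ i) m
poch≡Π z p zero    = refl
poch≡Π z p (suc m) = cong (_* (1ℚ - z * p ^ m)) (poch≡Π z p m)

poch-suc-shift : ∀ z p m → poch z p (suc m) ≡ (1ℚ - z) * poch (z * p) p m
poch-suc-shift z p m = begin
  poch z p (suc m)                                   ≡⟨ poch≡Π z p (suc m) ⟩
  Π (λ i → 1ℚ - z * p ^ i) (suc m)                   ≡⟨ Π-suc _ m ⟩
  (1ℚ - z * 1ℚ) * Π (λ i → 1ℚ - z * (p * p ^ i)) m   ≡⟨ cong₂ _*_ (cong (λ u → 1ℚ - u) (*-identityʳ z)) (Π-cong m (λ i → reassoc z p (p ^ i))) ⟩
  (1ℚ - z) * Π (λ i → 1ℚ - z * p * p ^ i) m          ≡⟨ cong ((1ℚ - z) *_) (sym (poch≡Π (z * p) p m)) ⟩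
  (1ℚ - z) * poch (z * p) p m                        ∎
  where
  open ≡-Reasoning
  reassoc : ∀ z p u → 1ℚ - z * (p * u) ≡ 1ℚ - z * p * u
  reassoc = solve-∀ ℚ-ring

poch-rescale : ∀ c d w p m → c * d ≡ 1ℚ → poch (c * w) p m ≡ c ^ m * Π (λ i → d - w * p ^ i) m
poch-rescale c d w p m cd≡1 = trans (poch≡Π (c * w) p m) (trans (Π-cong m factor) (Π-const-* c _ m))
  where
  factor : ∀ i → 1ℚ - c * w * p ^ i ≡ c * (d - w * p ^ i)
  factor i = trans (cong (λ one → one - c * w * p ^ i) (sym cd≡1)) (expand c d w (p ^ i))
    where
    expand : ∀ c d w u → c * d - c * w * u ≡ c * (d - w * u)
    expand = solve-∀ ℚ-ring

poch-square : ∀ z q n → poch (z * z) (q * q) n ≡ poch z q n * poch (- z) q n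
poch-square z q zero    = refl
poch-square z q (suc n) =
  trans (cong₂ _*_ (poch-square z q n) (cong (λ u → 1ℚ - z * z * u) (^-distribʳ-* q q n)))
        (difference-of-squares (poch z q n) (poch (- z) q n) z (q ^ n))
  where
  difference-of-squares : ∀ P P′ z u → P * P′ * (1ℚ - z * z * (u * u)) ≡ P * (1ℚ - z * u) * (P′ * (1ℚ - - z * u))
  difference-of-squares = solve-∀ ℚ-ring

poch≢0⇒factor≢0 : ∀ z p n → poch z p n ≢ 0ℚ → ∀ i → i < n → 1ℚ - z * p ^ i ≢ 0ℚ
poch≢0⇒factor≢0 z p n poch≢0 = Π≢0⇒factor≢0 _ n (λ Π≡0 → poch≢0 (trans (poch≡Π z p n) Π≡0))

-- Jackson's terminating 6W5 summation

-- With x = q^n and y = q^m, dividing the WZ step below by the factor common to its four terms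
-- leaves this polynomial identity.
wz-identity : ∀ a k q x y C →
  (1ℚ - q * x) * (1ℚ - k * x) * (a - k * x) * q * (k * x - a * y) * ((1ℚ - a * (y * y)) * (1ℚ - k * x * y) * C)
    ≡ (1ℚ - q * x) * (1ℚ - k * x) * k * ((1ℚ - a * (y * y)) * (y - q * x) * (k * x - a) * (1ℚ - a * q * x * y) * C)
      + ((k * x - a) * (1ℚ - k * q * x * x) * ((1ℚ - a * y) * (k - a * q * y) * (1ℚ - k * x * y) * (q * x - y)) * C
         - (k * x - a * y) * ((k * x - a) * (1ℚ - k * q * x * x) * ((1ℚ - y) * (q - k * y)) * (1ℚ - a * q * x * y) * C))
wz-identity = solve-∀ ℚ-ring

-- Its counterpart at m = n + 1, i.e. y = qx, where the shorter sum has no term.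
wz-boundary-identity : ∀ a k q x C →
  (1ℚ - q * x) * (1ℚ - k * x) * (a - k * x) * q * ((1ℚ - a * (q * x * (q * x))) * (1ℚ - k * x * (q * x)) * C)
    ≡ - ((k * x - a) * (1ℚ - k * q * x * x) * ((1ℚ - q * x) * (q - k * (q * x))) * (1ℚ - a * q * x * (q * x)) * C)
wz-boundary-identity = solve-∀ ℚ-ring

module Jackson (a k q : ℚ) where

  -- With x = q^n and y = q^m: B m = k^m (aq/k;q)_m, X n m = x^m (q^-n;q)_m,
  -- D n m = (kx)^m (aq/(kx);q)_m and Π (g n) m = (aqx;q)_m.  So for m ≤ n, term n m is
  -- (1 − a)(aqx;q)_n times the m-th term of 6W5(a; aq/k, kx, q^-n; q, 1).  Clearing (aqx;q)_n keeps
  -- the terms meaningful for all n below the one of the theorem, where nothing is known about it.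
  B : ℕ → ℚ
  B = Π (λ i → k - a * q * q ^ i)

  X : ℕ → ℕ → ℚ
  X n = Π (λ i → q ^ n - q ^ i)

  D : ℕ → ℕ → ℚ
  D n = Π (λ i → k * q ^ n - a * q * q ^ i)

  g : ℕ → ℕ → ℚ
  g n i = 1ℚ - a * q * q ^ n * q ^ i

  base : ℕ → ℚ
  base m = poch a q m * B m * inv (poch q q m) * inv (poch k q m)

  term : ℕ → ℕ → ℚ
  term n m = (1ℚ - a * (q ^ m * q ^ m)) * base m * poch (k * q ^ n) q m * X n m * inv (D n m)
             * Πfrom (g n) m (n ∸ m)

  S : ℕ → ℚ
  S n = sum≤ (term n) n

  -- μ and ν are the ratios of consecutive values of denom and value below (denom-suc,
  -- value-suc); ρ clears the denominators (1 − qx)(1 − kx) of the WZ certificate cert.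
  μ ν ρ : ℕ → ℚ
  μ n = (1ℚ - k * q ^ n) * (a - k * q ^ n) * q
  ν n = k * (1ℚ - q * q ^ n) * g n n * g n (suc n)
  ρ n = (1ℚ - q * q ^ n) * (1ℚ - k * q ^ n)

  cert : ℕ → ℕ → ℚ
  cert n m = (k * x - a) * (1ℚ - k * q * x * x) * base m * poch (k * x) q m * X (suc n) m * inv (D (suc n) m)
             * ((1ℚ - q ^ m) * (q - k * q ^ m)) * Πfrom (g n) m (suc (suc n) ∸ m)
    where x = q ^ n

  common : ℕ → ℕ → ℚ
  common n m = base m * poch (k * q ^ n) q m * X (suc n) m * inv (D (suc n) m) * Πfrom (g n) (suc m) (suc n ∸ m)

  poch-kx-shift : ∀ x m → poch (k * (q * x)) q m * (1ℚ - k * x) ≡ poch (k * x) q m * (1ℚ - k * x * q ^ m)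
  poch-kx-shift x m = begin
    poch (k * (q * x)) q m * (1ℚ - k * x)    ≡⟨ *-comm _ (1ℚ - k * x) ⟩
    (1ℚ - k * x) * poch (k * (q * x)) q m    ≡⟨ cong (λ z → (1ℚ - k * x) * poch z q m) (reassoc k q x) ⟩
    (1ℚ - k * x) * poch (k * x * q) q m      ≡⟨ sym (poch-suc-shift (k * x) q m) ⟩
    poch (k * x) q m * (1ℚ - k * x * q ^ m)  ∎
    where
    open ≡-Reasoning
    reassoc : ∀ k q x → k * (q * x) ≡ k * x * q
    reassoc = solve-∀ ℚ-ring

  g-shift : ∀ n s l → Πfrom (g (suc n)) s l ≡ Πfrom (g n) (suc s) l
  g-shift n s l = Π-cong l (λ i → reassoc a q (q ^ n) (q ^ (s ℕ.+ i)))
    where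
    reassoc : ∀ a q x u → 1ℚ - a * q * (q * x) * u ≡ 1ℚ - a * q * x * (q * u)
    reassoc = solve-∀ ℚ-ring

  X-shift : ∀ n m → (1ℚ - q * q ^ n) * q ^ m * X n m ≡ X (suc n) m * (q ^ m - q * q ^ n)
  X-shift n m = begin
    (1ℚ - q * x) * q ^ m * X n m         ≡⟨ negate (q * x) (q ^ m) (X n m) ⟩
    - ((q * x - 1ℚ) * (q ^ m * X n m))   ≡⟨ cong -_ (sym two-ways) ⟩
    - (X (suc n) m * (q * x - q ^ m))    ≡⟨ negate′ (X (suc n) m) (q * x) (q ^ m) ⟩
    X (suc n) m * (q ^ m - q * x)        ∎
    where
    open ≡-Reasoning
    x = q ^ n
    negate : ∀ z y P → (1ℚ - z) * y * P ≡ - ((z - 1ℚ) * (y * P))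
    negate = solve-∀ ℚ-ring
    negate′ : ∀ P z y → - (P * (z - y)) ≡ P * (y - z)
    negate′ = solve-∀ ℚ-ring
    factor-q : ∀ i → q * x - q * q ^ i ≡ q * (x - q ^ i)
    factor-q i = distrib q x (q ^ i)
      where
      distrib : ∀ q x u → q * x - q * u ≡ q * (x - u)
      distrib = solve-∀ ℚ-ring
    -- Both sides are ∏_{i ≤ m} (qx − q^i).
    two-ways : X (suc n) m * (q * x - q ^ m) ≡ (q * x - 1ℚ) * (q ^ m * X n m)
    two-ways = trans (Π-suc (λ i → q * x - q ^ i) m)
      (cong ((q * x - 1ℚ) *_) (trans (Π-cong m factor-q) (Π-const-* q (λ i → x - q ^ i) m)))

  D-shift : ∀ n m → D (suc n) m * (k * q ^ n - a * q ^ m) ≡ (q ^ m * (k * q ^ n - a)) * D n m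
  D-shift n m = begin
    D (suc n) m * (k * x - a * q ^ m)          ≡⟨ cong (_* (k * x - a * q ^ m)) (trans (Π-cong m factor-q) (Π-const-* q _ m)) ⟩
    q ^ m * Π f m * (k * x - a * q ^ m)        ≡⟨ *-assoc (q ^ m) (Π f m) _ ⟩
    q ^ m * Π f (suc m)                        ≡⟨ cong (q ^ m *_) (Π-suc f m) ⟩
    q ^ m * ((k * x - a * 1ℚ) * Π (λ i → f (suc i)) m)
      ≡⟨ cong₂ (λ u v → q ^ m * ((k * x - u) * v)) (*-identityʳ a) (Π-cong m (λ i → cong (λ u → k * x - u) (sym (*-assoc a q (q ^ i))))) ⟩
    q ^ m * ((k * x - a) * D n m)              ≡⟨ sym (*-assoc (q ^ m) (k * x - a) (D n m)) ⟩
    q ^ m * (k * x - a) * D n m                ∎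
    where
    open ≡-Reasoning
    x = q ^ n
    f : ℕ → ℚ
    f i = k * x - a * q ^ i
    factor-q : ∀ i → k * (q * x) - a * q * q ^ i ≡ q * f i
    factor-q i = distrib k q x a (q ^ i)
      where
      distrib : ∀ k q x a u → k * (q * x) - a * q * u ≡ q * (k * x - a * u)
      distrib = solve-∀ ℚ-ring

  tail-snoc : ∀ n m → m ≤ n → Πfrom (g n) m (n ∸ m) * (g n n * g n (suc n)) ≡ g n m * Πfrom (g n) (suc m) (suc n ∸ m)
  tail-snoc n m m≤n = begin
    Πfrom (g n) m d * (g n n * g n (suc n))
      ≡⟨ cong₂ (λ i j → Πfrom (g n) m d * (g n i * g n j)) (sym m+d≡n) (sym (trans (ℕ.+-suc m d) (cong suc m+d≡n))) ⟩
    Πfrom (g n) m d * (g n (m ℕ.+ d) * g n (m ℕ.+ suc d))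
      ≡⟨ sym (*-assoc (Πfrom (g n) m d) _ _) ⟩
    Πfrom (g n) m (suc (suc d))
      ≡⟨ Πfrom-suc (g n) m (suc d) ⟩
    g n m * Πfrom (g n) (suc m) (suc d)
      ≡⟨ cong (λ l → g n m * Πfrom (g n) (suc m) l) (sym (ℕ.+-∸-assoc 1 m≤n)) ⟩
    g n m * Πfrom (g n) (suc m) (suc n ∸ m) ∎
    where
    open ≡-Reasoning
    d = n ∸ m
    m+d≡n : m ℕ.+ d ≡ n
    m+d≡n = ℕ.m+[n∸m]≡n m≤n

  tail-unconsˡ : ∀ n m → m ≤ suc n → Πfrom (g n) m (suc (suc n) ∸ m) ≡ g n m * Πfrom (g n) (suc m) (suc n ∸ m)
  tail-unconsˡ n m m≤1+n = trans (cong (Πfrom (g n) m) (ℕ.+-∸-assoc 1 m≤1+n)) (Πfrom-suc (g n) m (suc n ∸ m))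

  base-suc : ∀ m → base (suc m) ≡ base m * ((1ℚ - a * q ^ m) * (k - a * q * q ^ m)) * (inv (1ℚ - q * q ^ m) * inv (1ℚ - k * q ^ m))
  base-suc m = trans (cong₂ (λ u v → poch a q m * α * (B m * β) * u * v) (inv-distrib-* (poch q q m) γ) (inv-distrib-* (poch k q m) δ))
                     (regroup (poch a q m) α (B m) β (inv (poch q q m)) (inv γ) (inv (poch k q m)) (inv δ))
    where
    α = 1ℚ - a * q ^ m
    β = k - a * q * q ^ m
    γ = 1ℚ - q * q ^ m
    δ = 1ℚ - k * q ^ m
    regroup : ∀ A α B β iQ iγ iK iδ → A * α * (B * β) * (iQ * iγ) * (iK * iδ) ≡ A * B * iQ * iK * (α * β) * (iγ * iδ)
    regroup = solve-∀ ℚ-ring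

  term-suc≡common : ∀ n m →
    (1ℚ - k * q ^ n) * term (suc n) m ≡ (1ℚ - a * (q ^ m * q ^ m)) * (1ℚ - k * q ^ n * q ^ m) * common n m
  term-suc≡common n m = begin
    (1ℚ - k * x) * (w * base m * poch (k * (q * x)) q m * X′ * iD′ * Πfrom (g (suc n)) m (suc n ∸ m))
      ≡⟨ regroup (1ℚ - k * x) w (base m) (poch (k * (q * x)) q m) X′ iD′ _ ⟩
    w * base m * (poch (k * (q * x)) q m * (1ℚ - k * x)) * X′ * iD′ * Πfrom (g (suc n)) m (suc n ∸ m)
      ≡⟨ cong₂ (λ P T → w * base m * P * X′ * iD′ * T) (poch-kx-shift x m) (g-shift n m (suc n ∸ m)) ⟩
    w * base m * (poch (k * x) q m * (1ℚ - k * x * q ^ m)) * X′ * iD′ * Πfrom (g n) (suc m) (suc n ∸ m)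
      ≡⟨ regroup′ w (1ℚ - k * x * q ^ m) (base m) (poch (k * x) q m) X′ iD′ _ ⟩
    w * (1ℚ - k * x * q ^ m) * common n m ∎
    where
    open ≡-Reasoning
    x = q ^ n
    w = 1ℚ - a * (q ^ m * q ^ m)
    X′ = X (suc n) m
    iD′ = inv (D (suc n) m)
    regroup : ∀ u w b P X iD T → u * (w * b * P * X * iD * T) ≡ w * b * (P * u) * X * iD * T
    regroup = solve-∀ ℚ-ring
    regroup′ : ∀ w e b P X iD T → w * b * (P * e) * X * iD * T ≡ w * e * (b * P * X * iD * T)
    regroup′ = solve-∀ ℚ-ring

  cert≡common : ∀ n m → m ≤ suc n →
    cert n m ≡ (k * q ^ n - a) * (1ℚ - k * q * q ^ n * q ^ n) * ((1ℚ - q ^ m) * (q - k * q ^ m)) * g n m * common n m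
  cert≡common n m m≤1+n = trans (cong (λ T → c * base m * P * X′ * iD′ * e * T) (tail-unconsˡ n m m≤1+n))
    (regroup c (base m) P X′ iD′ e (g n m) _)
    where
    c = (k * q ^ n - a) * (1ℚ - k * q * q ^ n * q ^ n)
    P = poch (k * q ^ n) q m
    X′ = X (suc n) m
    iD′ = inv (D (suc n) m)
    e = (1ℚ - q ^ m) * (q - k * q ^ m)
    regroup : ∀ c b P X iD e g T → c * b * P * X * iD * e * (g * T) ≡ c * e * g * (b * P * X * iD * T)
    regroup = solve-∀ ℚ-ring

  term≡common : ∀ n m → m ≤ n → q ≢ 0ℚ → k * q ^ n - a ≢ 0ℚ → k * q ^ n - a * q ^ m ≢ 0ℚ →
    (k * q ^ n - a * q ^ m) * ((1ℚ - q * q ^ n) * (g n n * g n (suc n)) * term n m)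
      ≡ (1ℚ - a * (q ^ m * q ^ m)) * (q ^ m - q * q ^ n) * (k * q ^ n - a) * g n m * common n m
  term≡common n m m≤n q≢0 kqⁿ-a≢0 kqⁿ-aqᵐ≢0 = begin
    Δ * (σ * G * (w * base m * P * X n m * inv (D n m) * T))
      ≡⟨ cong (λ iD → Δ * (σ * G * (w * base m * P * X n m * iD * T)))
              (inv-solve (D (suc n) m) Δ (y * (k * x - a)) (D n m) (D-shift n m) (*-≢0 (^-≢0 m q≢0) kqⁿ-a≢0)) ⟩
    Δ * (σ * G * (w * base m * P * X n m * (iD′ * inv Δ * (y * (k * x - a))) * T))
      ≡⟨ regroup Δ σ G w (base m) P (X n m) iD′ (inv Δ) y (k * x - a) T ⟩
    w * base m * P * (σ * y * X n m) * iD′ * (T * G) * (k * x - a) * (Δ * inv Δ)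
      ≡⟨ cong₃ (λ u v e → w * base m * P * u * iD′ * v * (k * x - a) * e)
               (X-shift n m) (tail-snoc n m m≤n) (p*inv[p]≡1 kqⁿ-aqᵐ≢0) ⟩
    w * base m * P * (X (suc n) m * (y - q * x)) * iD′ * (g n m * T′) * (k * x - a) * 1ℚ
      ≡⟨ regroup′ w (base m) P (X (suc n) m) (y - q * x) iD′ (g n m) T′ (k * x - a) ⟩
    w * (y - q * x) * (k * x - a) * g n m * common n m ∎
    where
    open ≡-Reasoning
    x = q ^ n
    y = q ^ m
    Δ = k * x - a * y
    σ = 1ℚ - q * x
    G = g n n * g n (suc n)
    w = 1ℚ - a * (y * y)
    P = poch (k * x) q m
    iD′ = inv (D (suc n) m)
    T = Πfrom (g n) m (n ∸ m)
    T′ = Πfrom (g n) (suc m) (suc n ∸ m)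
    regroup : ∀ Δ σ G w b P X iD′ iΔ y c T →
      Δ * (σ * G * (w * b * P * X * (iD′ * iΔ * (y * c)) * T)) ≡ w * b * P * (σ * y * X) * iD′ * (T * G) * c * (Δ * iΔ)
    regroup = solve-∀ ℚ-ring
    regroup′ : ∀ w b P X′ e iD′ g T′ c →
      w * b * P * (X′ * e) * iD′ * (g * T′) * c * 1ℚ ≡ w * e * c * g * (b * P * X′ * iD′ * T′)
    regroup′ = solve-∀ ℚ-ring

  cert-denominators-cancel : ∀ n m → q ≢ 0ℚ → 1ℚ - q * q ^ m ≢ 0ℚ → 1ℚ - k * q ^ m ≢ 0ℚ → k * q ^ n - a * q ^ m ≢ 0ℚ →
    (k * q ^ n - a * q ^ m) * ((1ℚ - q * q ^ m) * (q - k * (q * q ^ m)))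
      * (inv (1ℚ - q * q ^ m) * inv (1ℚ - k * q ^ m) * inv (k * (q * q ^ n) - a * q * q ^ m)) ≡ 1ℚ
  cert-denominators-cancel n m q≢0 1-qqᵐ≢0 1-kqᵐ≢0 kqⁿ-aqᵐ≢0 = begin
    (k * x - a * y) * ((1ℚ - q * y) * (q - k * (q * y))) * (inv (1ℚ - q * y) * inv (1ℚ - k * y) * inv ε)
      ≡⟨ split a k q x y (inv (1ℚ - q * y)) (inv (1ℚ - k * y)) (inv ε) ⟩
    ((1ℚ - q * y) * inv (1ℚ - q * y)) * ((1ℚ - k * y) * inv (1ℚ - k * y)) * (ε * inv ε)
      ≡⟨ cong₃ (λ u v w → u * v * w) (p*inv[p]≡1 1-qqᵐ≢0) (p*inv[p]≡1 1-kqᵐ≢0) (p*inv[p]≡1 ε≢0) ⟩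
    1ℚ ∎
    where
    open ≡-Reasoning
    x = q ^ n
    y = q ^ m
    ε = k * (q * x) - a * q * y
    factor-q : ∀ k q x a y → q * (k * x - a * y) ≡ k * (q * x) - a * q * y
    factor-q = solve-∀ ℚ-ring
    ε≢0 : ε ≢ 0ℚ
    ε≢0 ε≡0 = *-≢0 q≢0 kqⁿ-aqᵐ≢0 (trans (factor-q k q x a y) ε≡0)
    split : ∀ a k q x y iγ iδ iε →
      (k * x - a * y) * ((1ℚ - q * y) * (q - k * (q * y))) * (iγ * iδ * iε)
        ≡ ((1ℚ - q * y) * iγ) * ((1ℚ - k * y) * iδ) * ((k * (q * x) - a * q * y) * iε)
    split = solve-∀ ℚ-ring

  cert-suc≡common : ∀ n m → q ≢ 0ℚ → 1ℚ - q * q ^ m ≢ 0ℚ → 1ℚ - k * q ^ m ≢ 0ℚ → k * q ^ n - a * q ^ m ≢ 0ℚ →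
    (k * q ^ n - a * q ^ m) * cert n (suc m)
      ≡ (k * q ^ n - a) * (1ℚ - k * q * q ^ n * q ^ n)
        * ((1ℚ - a * q ^ m) * (k - a * q * q ^ m) * (1ℚ - k * q ^ n * q ^ m) * (q * q ^ n - q ^ m)) * common n m
  cert-suc≡common n m q≢0 1-qqᵐ≢0 1-kqᵐ≢0 kqⁿ-aqᵐ≢0 = begin
    Δ * (c * base (suc m) * (P * π) * (X′ * χ) * inv (D′ * ε) * e * T)
      ≡⟨ cong₂ (λ u v → Δ * (c * u * (P * π) * (X′ * χ) * v * e * T)) (base-suc m) (inv-distrib-* D′ ε) ⟩
    Δ * (c * (base m * αβ * iγδ) * (P * π) * (X′ * χ) * (inv D′ * inv ε) * e * T)
      ≡⟨ regroup Δ c (base m) αβ iγδ P π X′ χ (inv D′) (inv ε) e T ⟩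
    c * (αβ * π * χ) * common n m * (Δ * e * (iγδ * inv ε))
      ≡⟨ cong (c * (αβ * π * χ) * common n m *_) (cert-denominators-cancel n m q≢0 1-qqᵐ≢0 1-kqᵐ≢0 kqⁿ-aqᵐ≢0) ⟩
    c * (αβ * π * χ) * common n m * 1ℚ
      ≡⟨ *-identityʳ _ ⟩
    c * (αβ * π * χ) * common n m ∎
    where
    open ≡-Reasoning
    x = q ^ n
    y = q ^ m
    Δ = k * x - a * y
    c = (k * x - a) * (1ℚ - k * q * x * x)
    P = poch (k * x) q m
    X′ = X (suc n) m
    D′ = D (suc n) m
    T = Πfrom (g n) (suc m) (suc n ∸ m)
    e = (1ℚ - q * y) * (q - k * (q * y))
    αβ = (1ℚ - a * y) * (k - a * q * y)
    iγδ = inv (1ℚ - q * y) * inv (1ℚ - k * y)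
    π = 1ℚ - k * x * y
    χ = q * x - y
    ε = k * (q * x) - a * q * y
    regroup : ∀ Δ c b αβ iγδ P π X χ iD iε e T →
      Δ * (c * (b * αβ * iγδ) * (P * π) * (X * χ) * (iD * iε) * e * T)
        ≡ c * (αβ * π * χ) * (b * P * X * iD * T) * (Δ * e * (iγδ * iε))
    regroup = solve-∀ ℚ-ring

  wz-step : ∀ n m → m ≤ n → q ≢ 0ℚ → 1ℚ - q * q ^ m ≢ 0ℚ → 1ℚ - k * q ^ m ≢ 0ℚ →
    k * q ^ n - a ≢ 0ℚ → k * q ^ n - a * q ^ m ≢ 0ℚ →
    ρ n * μ n * term (suc n) m ≡ ρ n * ν n * term n m + (cert n (suc m) - cert n m)
  wz-step n m m≤n q≢0 1-qqᵐ≢0 1-kqᵐ≢0 kqⁿ-a≢0 kqⁿ-aqᵐ≢0 = *-cancelʳ-≡ _ _ kqⁿ-aqᵐ≢0 (begin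
    ρ n * μ n * term (suc n) m * Δ
      ≡⟨ regroupˡ σ κ (a - k * x) q (term (suc n) m) Δ ⟩
    σ * κ * (a - k * x) * q * Δ * (κ * term (suc n) m)
      ≡⟨ cong (σ * κ * (a - k * x) * q * Δ *_) (term-suc≡common n m) ⟩
    σ * κ * (a - k * x) * q * Δ * ((1ℚ - a * (y * y)) * (1ℚ - k * x * y) * C)
      ≡⟨ wz-identity a k q x y C ⟩
    σ * κ * k * ((1ℚ - a * (y * y)) * (y - q * x) * (k * x - a) * g n m * C)
      + (c * ((1ℚ - a * y) * (k - a * q * y) * (1ℚ - k * x * y) * (q * x - y)) * C
         - Δ * (c * ((1ℚ - y) * (q - k * y)) * g n m * C))
      ≡⟨ sym (cong₃ (λ u v z → σ * κ * k * u + (v - Δ * z))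
                    (term≡common n m m≤n q≢0 kqⁿ-a≢0 kqⁿ-aqᵐ≢0)
                    (cert-suc≡common n m q≢0 1-qqᵐ≢0 1-kqᵐ≢0 kqⁿ-aqᵐ≢0)
                    (cert≡common n m (ℕ.m≤n⇒m≤1+n m≤n))) ⟩
    σ * κ * k * (Δ * (σ * (g n n * g n (suc n)) * term n m)) + (Δ * cert n (suc m) - Δ * cert n m)
      ≡⟨ regroupʳ σ κ k (g n n) (g n (suc n)) (term n m) (cert n (suc m)) (cert n m) Δ ⟩
    (ρ n * ν n * term n m + (cert n (suc m) - cert n m)) * Δ ∎)
    where
    open ≡-Reasoning
    x = q ^ n
    y = q ^ m
    σ = 1ℚ - q * x
    κ = 1ℚ - k * x
    Δ = k * x - a * y
    c = (k * x - a) * (1ℚ - k * q * x * x)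
    C = common n m
    regroupˡ : ∀ σ κ e q t Δ → σ * κ * (κ * e * q) * t * Δ ≡ σ * κ * e * q * Δ * (κ * t)
    regroupˡ = solve-∀ ℚ-ring
    regroupʳ : ∀ σ κ k g₁ g₂ t h₊ h Δ →
      σ * κ * k * (Δ * (σ * (g₁ * g₂) * t)) + (Δ * h₊ - Δ * h) ≡ (σ * κ * (k * σ * g₁ * g₂) * t + (h₊ - h)) * Δ
    regroupʳ = solve-∀ ℚ-ring

  wz-boundary : ∀ n → ρ n * μ n * term (suc n) (suc n) ≡ - cert n (suc n)
  wz-boundary n = begin
    ρ n * μ n * term (suc n) (suc n)
      ≡⟨ regroup (1ℚ - q * x) (1ℚ - k * x) (a - k * x) q (term (suc n) (suc n)) ⟩
    (1ℚ - q * x) * (1ℚ - k * x) * (a - k * x) * q * ((1ℚ - k * x) * term (suc n) (suc n))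
      ≡⟨ cong ((1ℚ - q * x) * (1ℚ - k * x) * (a - k * x) * q *_) (term-suc≡common n (suc n)) ⟩
    (1ℚ - q * x) * (1ℚ - k * x) * (a - k * x) * q * ((1ℚ - a * (q * x * (q * x))) * (1ℚ - k * x * (q * x)) * C)
      ≡⟨ wz-boundary-identity a k q x C ⟩
    - ((k * x - a) * (1ℚ - k * q * x * x) * ((1ℚ - q * x) * (q - k * (q * x))) * g n (suc n) * C)
      ≡⟨ cong -_ (sym (cert≡common n (suc n) ℕ.≤-refl)) ⟩
    - cert n (suc n) ∎
    where
    open ≡-Reasoning
    x = q ^ n
    C = common n (suc n)
    regroup : ∀ σ κ e q t → σ * κ * (κ * e * q) * t ≡ σ * κ * e * q * (κ * t)
    regroup = solve-∀ ℚ-ring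

  cert-zero : ∀ n → cert n 0 ≡ 0ℚ
  cert-zero n = vanishes (k * q ^ n - a) (1ℚ - k * q * q ^ n * q ^ n) (base 0) (inv (D (suc n) 0)) (q - k * 1ℚ)
                         (Πfrom (g n) 0 (suc (suc n)))
    where
    vanishes : ∀ c c′ b iD r T → c * c′ * b * 1ℚ * 1ℚ * iD * ((1ℚ - 1ℚ) * r) * T ≡ 0ℚ
    vanishes = solve-∀ ℚ-ring

  recurrence : ∀ n → q ≢ 0ℚ → (∀ m → m ≤ n → 1ℚ - q * q ^ m ≢ 0ℚ) → (∀ m → m ≤ n → 1ℚ - k * q ^ m ≢ 0ℚ) →
    (∀ m → m ≤ n → k * q ^ n - a * q ^ m ≢ 0ℚ) → μ n * S (suc n) ≡ ν n * S n
  recurrence n q≢0 1-qqᵐ≢0 1-kqᵐ≢0 kqⁿ-aqᵐ≢0 = *-cancelˡ-≡ _ _ ρ≢0 (begin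
    ρ n * (μ n * S (suc n))                          ≡⟨ sym (*-assoc (ρ n) (μ n) _) ⟩
    ρ n * μ n * S (suc n)                            ≡⟨ sym (sum≤-const-* (ρ n * μ n) (term (suc n)) (suc n)) ⟩
    sum≤ (λ m → ρ n * μ n * term (suc n) m) (suc n)  ≡⟨ telescope _ _ (cert n) n step (wz-boundary n) (cert-zero n) ⟩
    sum≤ (λ m → ρ n * ν n * term n m) n              ≡⟨ sum≤-const-* (ρ n * ν n) (term n) n ⟩
    ρ n * ν n * S n                                  ≡⟨ *-assoc (ρ n) (ν n) _ ⟩
    ρ n * (ν n * S n)                                ∎)
    where
    open ≡-Reasoning
    ρ≢0 : ρ n ≢ 0ℚ
    ρ≢0 = *-≢0 (1-qqᵐ≢0 n ℕ.≤-refl) (1-kqᵐ≢0 n ℕ.≤-refl)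
    kqⁿ-a≢0 : k * q ^ n - a ≢ 0ℚ
    kqⁿ-a≢0 = subst (λ u → k * q ^ n - u ≢ 0ℚ) (*-identityʳ a) (kqⁿ-aqᵐ≢0 0 z≤n)
    step : ∀ m → m ≤ n → ρ n * μ n * term (suc n) m ≡ ρ n * ν n * term n m + (cert n (suc m) - cert n m)
    step m m≤n = wz-step n m m≤n q≢0 (1-qqᵐ≢0 m m≤n) (1-kqᵐ≢0 m m≤n) kqⁿ-a≢0 (kqⁿ-aqᵐ≢0 m m≤n)

  denom value : ℕ → ℚ
  denom n = poch k q n * Π (λ i → a - k * q ^ i) n * q ^ n
  value n = (1ℚ - a) * poch (a * q) q (n ℕ.+ n) * poch q q n * k ^ n

  denom-suc : ∀ n → denom (suc n) ≡ denom n * μ n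
  denom-suc n = regroup (poch k q n) (1ℚ - k * q ^ n) (Π (λ i → a - k * q ^ i) n) (a - k * q ^ n) q (q ^ n)
    where
    regroup : ∀ K κ P e q x → K * κ * (P * e) * (q * x) ≡ K * P * x * (κ * e * q)
    regroup = solve-∀ ℚ-ring

  value-suc : ∀ n → value (suc n) ≡ ν n * value n
  value-suc n = begin
    (1ℚ - a) * poch (a * q) q (suc (n ℕ.+ suc n)) * Q′ * k ^ suc n
      ≡⟨ cong (λ j → (1ℚ - a) * poch (a * q) q (suc j) * Q′ * k ^ suc n) (ℕ.+-suc n n) ⟩
    (1ℚ - a) * (poch (a * q) q (n ℕ.+ n) * (1ℚ - a * q * q ^ (n ℕ.+ n)) * (1ℚ - a * q * (q * q ^ (n ℕ.+ n)))) * Q′ * k ^ suc n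
      ≡⟨ cong (λ z → (1ℚ - a) * (poch (a * q) q (n ℕ.+ n) * (1ℚ - a * q * z) * (1ℚ - a * q * (q * z))) * Q′ * k ^ suc n)
              (^-distribˡ-+-* q n n) ⟩
    (1ℚ - a) * (poch (a * q) q (n ℕ.+ n) * (1ℚ - a * q * (x * x)) * (1ℚ - a * q * (q * (x * x)))) * Q′ * k ^ suc n
      ≡⟨ regroup a k q x (poch (a * q) q (n ℕ.+ n)) (poch q q n) (k ^ n) ⟩
    ν n * value n ∎
    where
    open ≡-Reasoning
    x = q ^ n
    Q′ = poch q q (suc n)
    regroup : ∀ a k q x P Q K →
      (1ℚ - a) * (P * (1ℚ - a * q * (x * x)) * (1ℚ - a * q * (q * (x * x)))) * (Q * (1ℚ - q * x)) * (k * K)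
        ≡ k * (1ℚ - q * x) * (1ℚ - a * q * x * x) * (1ℚ - a * q * x * (q * x)) * ((1ℚ - a) * P * Q * K)
    regroup = solve-∀ ℚ-ring

  closed-form : ∀ N → q ≢ 0ℚ → (∀ i → i < N → 1ℚ - q * q ^ i ≢ 0ℚ) → (∀ i → i < N → 1ℚ - k * q ^ i ≢ 0ℚ) →
    (∀ n j → n < N → j ≤ n → k * q ^ n - a * q ^ j ≢ 0ℚ) → ∀ n → n ≤ N → S n * denom n ≡ value n
  closed-form N q≢0 1-qqⁱ≢0 1-kqⁱ≢0 kqⁿ-aqʲ≢0 zero    _     = initial a
    where
    -- S 0 * denom 0 and value 0 compute to the two sides (inv 1ℚ reduces to 1ℚ).
    initial : ∀ a → (1ℚ - a * (1ℚ * 1ℚ)) * (1ℚ * 1ℚ * 1ℚ * 1ℚ) * 1ℚ * 1ℚ * 1ℚ * 1ℚ * (1ℚ * 1ℚ * 1ℚ) ≡ (1ℚ - a) * 1ℚ * 1ℚ * 1ℚ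
    initial = solve-∀ ℚ-ring
  closed-form N q≢0 1-qqⁱ≢0 1-kqⁱ≢0 kqⁿ-aqʲ≢0 (suc n) n<N = begin
    S (suc n) * denom (suc n)      ≡⟨ cong (S (suc n) *_) (denom-suc n) ⟩
    S (suc n) * (denom n * μ n)    ≡⟨ regroup (S (suc n)) (denom n) (μ n) ⟩
    denom n * (μ n * S (suc n))    ≡⟨ cong (denom n *_) (recurrence n q≢0 (below 1-qqⁱ≢0) (below 1-kqⁱ≢0) (λ j → kqⁿ-aqʲ≢0 n j n<N)) ⟩
    denom n * (ν n * S n)          ≡⟨ regroup′ (denom n) (ν n) (S n) ⟩
    ν n * (S n * denom n)          ≡⟨ cong (ν n *_) (closed-form N q≢0 1-qqⁱ≢0 1-kqⁱ≢0 kqⁿ-aqʲ≢0 n (ℕ.<⇒≤ n<N)) ⟩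
    ν n * value n                  ≡⟨ sym (value-suc n) ⟩
    value (suc n)                  ∎
    where
    open ≡-Reasoning
    below : ∀ {P : ℕ → Set} → (∀ i → i < N → P i) → ∀ m → m ≤ n → P m
    below P<N m m≤n = P<N m (ℕ.≤-<-trans m≤n n<N)
    regroup : ∀ s e r → s * (e * r) ≡ e * (r * s)
    regroup = solve-∀ ℚ-ring
    regroup′ : ∀ e r s → e * (r * s) ≡ r * (s * e)
    regroup′ = solve-∀ ℚ-ring

  poch-aq/b : ∀ b m → b ≢ 0ℚ → b * k ≡ a * q → poch (a * q /' b) q m ≡ poch k q m
  poch-aq/b b m b≢0 bk≡aq = cong (λ z → poch z q m) (begin
    a * q * inv b      ≡⟨ cong (_* inv b) (sym bk≡aq) ⟩
    b * k * inv b      ≡⟨ swap b k (inv b) ⟩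
    b * inv b * k      ≡⟨ cong (_* k) (p*inv[p]≡1 b≢0) ⟩
    1ℚ * k             ≡⟨ *-identityˡ k ⟩
    k                  ∎)
    where
    open ≡-Reasoning
    swap : ∀ u v w → u * v * w ≡ u * w * v
    swap = solve-∀ ℚ-ring

  poch-b : ∀ b m → k ≢ 0ℚ → b * k ≡ a * q → poch b q m ≡ inv k ^ m * B m
  poch-b b m k≢0 bk≡aq = trans (cong (λ z → poch z q m) b≡)
    (poch-rescale (inv k) k (a * q) q m (trans (*-comm (inv k) k) (p*inv[p]≡1 k≢0)))
    where
    b≡ : b ≡ inv k * (a * q)
    b≡ = *-cancelʳ-≡ b (inv k * (a * q)) k≢0
           (trans bk≡aq (sym (trans (cong (_* k) (*-comm (inv k) (a * q))) (x*inv[y]*y≡x (a * q) k≢0))))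

  poch-inv-qⁿ : ∀ n m → q ≢ 0ℚ → poch (inv q ^ n) q m ≡ inv (q ^ n) ^ m * X n m
  poch-inv-qⁿ n m q≢0 = begin
    poch (inv q ^ n) q m                               ≡⟨ cong (λ z → poch z q m) (trans (sym (inv-^ q n)) (sym (*-identityʳ _))) ⟩
    poch (inv (q ^ n) * 1ℚ) q m                        ≡⟨ poch-rescale (inv (q ^ n)) (q ^ n) 1ℚ q m ix·x≡1 ⟩
    inv (q ^ n) ^ m * Π (λ i → q ^ n - 1ℚ * q ^ i) m   ≡⟨ cong (inv (q ^ n) ^ m *_) (Π-cong m (λ i → cong (λ u → q ^ n - u) (*-identityˡ (q ^ i)))) ⟩
    inv (q ^ n) ^ m * X n m                            ∎
    where
    open ≡-Reasoning
    ix·x≡1 : inv (q ^ n) * q ^ n ≡ 1ℚ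
    ix·x≡1 = trans (*-comm _ (q ^ n)) (p*inv[p]≡1 (^-≢0 n q≢0))

  poch-aq/kqⁿ : ∀ n m → k * q ^ n ≢ 0ℚ → poch (a * q /' (k * q ^ n)) q m ≡ inv (k * q ^ n) ^ m * D n m
  poch-aq/kqⁿ n m kx≢0 = trans (cong (λ z → poch z q m) (*-comm (a * q) _))
    (poch-rescale (inv (k * q ^ n)) (k * q ^ n) (a * q) q m (trans (*-comm _ (k * q ^ n)) (p*inv[p]≡1 kx≢0)))

  poch-aqⁿ⁺¹ : ∀ n m → poch (a * q /' (inv q ^ n)) q m ≡ Π (g n) m
  poch-aqⁿ⁺¹ n m = trans (cong (λ z → poch z q m) aq/q⁻ⁿ≡) (poch≡Π (a * q * q ^ n) q m)
    where
    aq/q⁻ⁿ≡ : a * q * inv (inv q ^ n) ≡ a * q * q ^ n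
    aq/q⁻ⁿ≡ = cong (λ z → a * q * z) (trans (cong inv (sym (inv-^ q n))) (inv-involutive (q ^ n)))

  W6-fraction≡ : ∀ b n m → q ≢ 0ℚ → k ≢ 0ℚ → b ≢ 0ℚ → b * k ≡ a * q →
    (poch a q m * poch b q m * poch (k * q ^ n) q m * poch (inv q ^ n) q m)
      /' (poch q q m * poch (a * q /' b) q m * poch (a * q /' (k * q ^ n)) q m * poch (a * q /' (inv q ^ n)) q m)
      ≡ base m * poch (k * q ^ n) q m * X n m * inv (D n m) * 1ℚ * inv (Π (g n) m)
  W6-fraction≡ b n m q≢0 k≢0 b≢0 bk≡aq = begin
    (A * poch b q m * K * poch (inv q ^ n) q m) * inv (Q * poch (a * q /' b) q m * poch (a * q /' (k * x)) q m * poch (a * q /' (inv q ^ n)) q m)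
      ≡⟨ cong₂ _*_ (cong₂ (λ u v → A * u * K * v) (poch-b b m k≢0 bk≡aq) (poch-inv-qⁿ n m q≢0))
                   (cong inv (cong₃ (λ u v w → Q * u * v * w) (poch-aq/b b m b≢0 bk≡aq) (poch-aq/kqⁿ n m kx≢0) (poch-aqⁿ⁺¹ n m))) ⟩
    A * (inv k ^ m * B m) * K * (inv x ^ m * X n m) * inv (Q * Kk * (s * D n m) * G)
      ≡⟨ cong (A * (inv k ^ m * B m) * K * (inv x ^ m * X n m) *_) inv-denominator≡ ⟩
    A * (inv k ^ m * B m) * K * (inv x ^ m * X n m) * (inv Q * inv Kk * ((k * x) ^ m * inv (D n m)) * inv G)
      ≡⟨ separate A (inv k ^ m) (B m) K (inv x ^ m) (X n m) (inv Q) (inv Kk) ((k * x) ^ m) (inv (D n m)) (inv G) ⟩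
    base m * K * X n m * inv (D n m) * (inv k ^ m * inv x ^ m * (k * x) ^ m) * inv G
      ≡⟨ cong (λ z → base m * K * X n m * inv (D n m) * z * inv G) scalings-cancel ⟩
    base m * K * X n m * inv (D n m) * 1ℚ * inv G ∎
    where
    open ≡-Reasoning
    x = q ^ n
    A = poch a q m
    K = poch (k * x) q m
    Q = poch q q m
    Kk = poch k q m
    G = Π (g n) m
    s = inv (k * x) ^ m
    kx≢0 : k * x ≢ 0ℚ
    kx≢0 = *-≢0 k≢0 (^-≢0 n q≢0)
    inv-denominator≡ : inv (Q * Kk * (s * D n m) * G) ≡ inv Q * inv Kk * ((k * x) ^ m * inv (D n m)) * inv G
    inv-denominator≡ = begin
      inv (Q * Kk * (s * D n m) * G)
        ≡⟨ trans (inv-distrib-* (Q * Kk * (s * D n m)) G)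
                 (cong (_* inv G) (trans (inv-distrib-* (Q * Kk) (s * D n m)) (cong₂ _*_ (inv-distrib-* Q Kk) (inv-distrib-* s (D n m))))) ⟩
      inv Q * inv Kk * (inv s * inv (D n m)) * inv G
        ≡⟨ cong (λ z → inv Q * inv Kk * (z * inv (D n m)) * inv G) (trans (inv-^ (inv (k * x)) m) (cong (_^ m) (inv-involutive (k * x)))) ⟩
      inv Q * inv Kk * ((k * x) ^ m * inv (D n m)) * inv G ∎
    pair-up : ∀ ik ix k x → ik * ix * (k * x) ≡ (k * ik) * (x * ix)
    pair-up = solve-∀ ℚ-ring
    scalings-cancel : inv k ^ m * inv x ^ m * (k * x) ^ m ≡ 1ℚ
    scalings-cancel = begin
      inv k ^ m * inv x ^ m * (k * x) ^ m   ≡⟨ sym (trans (^-distribʳ-* _ (k * x) m) (cong (_* (k * x) ^ m) (^-distribʳ-* (inv k) (inv x) m))) ⟩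
      (inv k * inv x * (k * x)) ^ m         ≡⟨ cong (_^ m) (trans (pair-up (inv k) (inv x) k x) (cong₂ _*_ (p*inv[p]≡1 k≢0) (p*inv[p]≡1 (^-≢0 n q≢0)))) ⟩
      (1ℚ * 1ℚ) ^ m                         ≡⟨ 1^n≡1 m ⟩
      1ℚ                                    ∎
    separate : ∀ A ik B K ix X iQ iK kx iD iG →
      A * (ik * B) * K * (ix * X) * (iQ * iK * (kx * iD) * iG) ≡ A * B * iQ * iK * K * X * iD * (ik * ix * kx) * iG
    separate = solve-∀ ℚ-ring

  W6term-rescaled : ∀ b n m → q ≢ 0ℚ → k ≢ 0ℚ → b ≢ 0ℚ → b * k ≡ a * q → 1ℚ - a ≢ 0ℚ → Π (g n) m ≢ 0ℚ →
    (1ℚ - a) * W6term a b (k * q ^ n) (inv q ^ n) q 1ℚ m * Π (g n) m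
      ≡ (1ℚ - a * (q ^ m * q ^ m)) * base m * poch (k * q ^ n) q m * X n m * inv (D n m)
  W6term-rescaled b n m q≢0 k≢0 b≢0 bk≡aq 1-a≢0 G≢0 = begin
    (1ℚ - a) * ((1ℚ - a * q ^ (2 ℕ.* m)) * inv (1ℚ - a) * fraction * 1ℚ ^ m) * G
      ≡⟨ cong₃ (λ u v o → (1ℚ - a) * ((1ℚ - a * u) * inv (1ℚ - a) * v * o) * G)
               q²ᵐ≡ (W6-fraction≡ b n m q≢0 k≢0 b≢0 bk≡aq) (1^n≡1 m) ⟩
    (1ℚ - a) * (w * inv (1ℚ - a) * (R * 1ℚ * inv G) * 1ℚ) * G
      ≡⟨ regroup (1ℚ - a) w (inv (1ℚ - a)) (base m) K (X n m) (inv (D n m)) (inv G) G ⟩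
    R′ * (((1ℚ - a) * inv (1ℚ - a)) * (G * inv G))
      ≡⟨ cong (R′ *_) (cong₂ _*_ (p*inv[p]≡1 1-a≢0) (p*inv[p]≡1 G≢0)) ⟩
    R′ * (1ℚ * 1ℚ)
      ≡⟨ *-identityʳ R′ ⟩
    R′ ∎
    where
    open ≡-Reasoning
    y = q ^ m
    w = 1ℚ - a * (y * y)
    K = poch (k * q ^ n) q m
    G = Π (g n) m
    R = base m * K * X n m * inv (D n m)
    R′ = w * base m * K * X n m * inv (D n m)
    fraction = (poch a q m * poch b q m * K * poch (inv q ^ n) q m)
                 /' (poch q q m * poch (a * q /' b) q m * poch (a * q /' (k * q ^ n)) q m * poch (a * q /' (inv q ^ n)) q m)
    q²ᵐ≡ : q ^ (2 ℕ.* m) ≡ y * y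
    q²ᵐ≡ = trans (cong (q ^_) (cong (m ℕ.+_) (ℕ.+-identityʳ m))) (^-distribˡ-+-* q m m)
    regroup : ∀ d w id b K X iD iG G →
      d * (w * id * (b * K * X * iD * 1ℚ * iG) * 1ℚ) * G ≡ w * b * K * X * iD * ((d * id) * (G * iG))
    regroup = solve-∀ ℚ-ring

  W6-rescaled : ∀ b n → q ≢ 0ℚ → k ≢ 0ℚ → b * k ≡ a * q → W6ok a b (k * q ^ n) (inv q ^ n) q n →
    (1ℚ - a) * Π (g n) n * W6 a b (k * q ^ n) (inv q ^ n) q 1ℚ n ≡ S n
  W6-rescaled b n q≢0 k≢0 bk≡aq (1-a≢0 , b≢0 , _ , _ , dens≢0) = begin
    (1ℚ - a) * Π (g n) n * W6 a b (k * q ^ n) (inv q ^ n) q 1ℚ n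
      ≡⟨ cong ((1ℚ - a) * Π (g n) n *_) (W6≡sum≤ a b (k * q ^ n) (inv q ^ n) q 1ℚ n) ⟩
    (1ℚ - a) * Π (g n) n * sum≤ t n
      ≡⟨ sym (sum≤-const-* ((1ℚ - a) * Π (g n) n) t n) ⟩
    sum≤ (λ m → (1ℚ - a) * Π (g n) n * t m) n
      ≡⟨ sum≤-cong n rescaled-term ⟩
    S n ∎
    where
    open ≡-Reasoning
    t = W6term a b (k * q ^ n) (inv q ^ n) q 1ℚ
    regroup : ∀ d G T u → d * (G * T) * u ≡ d * u * G * T
    regroup = solve-∀ ℚ-ring
    rescaled-term : ∀ m → m ≤ n → (1ℚ - a) * Π (g n) n * t m ≡ term n m
    rescaled-term m m≤n = begin
      (1ℚ - a) * Π (g n) n * t m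
        ≡⟨ cong (λ G → (1ℚ - a) * G * t m) (trans (cong (Π (g n)) (sym (ℕ.m+[n∸m]≡n m≤n))) (Π-+ (g n) m (n ∸ m))) ⟩
      (1ℚ - a) * (Π (g n) m * Πfrom (g n) m (n ∸ m)) * t m
        ≡⟨ regroup (1ℚ - a) (Π (g n) m) (Πfrom (g n) m (n ∸ m)) (t m) ⟩
      (1ℚ - a) * t m * Π (g n) m * Πfrom (g n) m (n ∸ m)
        ≡⟨ cong (_* Πfrom (g n) m (n ∸ m)) (W6term-rescaled b n m q≢0 k≢0 b≢0 bk≡aq 1-a≢0 Gₘ≢0) ⟩
      term n m ∎
      where
      Gₘ≢0 : Π (g n) m ≢ 0ℚ
      Gₘ≢0 = subst (_≢ 0ℚ) (poch-aqⁿ⁺¹ n m) (proj₂ (proj₂ (proj₂ (dens≢0 m m≤n))))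

  kqⁿ-aqʲ≢0 : ∀ N → q ≢ 0ℚ → k ≢ 0ℚ → poch (a * q /' (k * q ^ N)) q N ≢ 0ℚ →
    ∀ n j → n < N → j ≤ n → k * q ^ n - a * q ^ j ≢ 0ℚ
  kqⁿ-aqʲ≢0 N q≢0 k≢0 poch≢0 n j n<N j≤n gap≡0 = poch≢0⇒factor≢0 (a * q /' c) q N poch≢0 i i<N factor≡0
    where
    open ≡-Reasoning
    t = N ∸ suc n
    i = t ℕ.+ j
    1+n+t≡N : suc n ℕ.+ t ≡ N
    1+n+t≡N = ℕ.m+[n∸m]≡n n<N
    i<N : i < N
    i<N = subst (i <_) (trans (ℕ.+-comm t (suc n)) 1+n+t≡N) (ℕ.+-monoʳ-< t (s≤s j≤n))
    c = k * q ^ N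
    c≢0 : c ≢ 0ℚ
    c≢0 = *-≢0 k≢0 (^-≢0 N q≢0)
    clear : ∀ c ic a q u → c * (1ℚ - a * q * ic * u) ≡ c - a * (q * u) * (c * ic)
    clear = solve-∀ ℚ-ring
    factor : ∀ k a Q x y → k * (Q * x) - a * (Q * y) * 1ℚ ≡ Q * (k * x - a * y)
    factor = solve-∀ ℚ-ring
    -- As N = (t + 1) + n and i + 1 = (t + 1) + j, the i-th factor is q^(t+1) (k q^n − a q^j) / (k q^N).
    factor≡0 : 1ℚ - a * q /' c * q ^ i ≡ 0ℚ
    factor≡0 = *-cancelˡ-≡ _ 0ℚ c≢0 (begin
      c * (1ℚ - a * q * inv c * q ^ i)
        ≡⟨ clear c (inv c) a q (q ^ i) ⟩
      k * q ^ N - a * q ^ (suc t ℕ.+ j) * (c * inv c)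
        ≡⟨ cong₃ (λ u v w → k * u - a * v * w)
                 (trans (cong (q ^_) (sym (trans (cong suc (ℕ.+-comm t n)) 1+n+t≡N))) (^-distribˡ-+-* q (suc t) n))
                 (^-distribˡ-+-* q (suc t) j) (p*inv[p]≡1 c≢0) ⟩
      k * (q ^ suc t * q ^ n) - a * (q ^ suc t * q ^ j) * 1ℚ
        ≡⟨ factor k a (q ^ suc t) (q ^ n) (q ^ j) ⟩
      q ^ suc t * (k * q ^ n - a * q ^ j)
        ≡⟨ cong (q ^ suc t *_) gap≡0 ⟩
      q ^ suc t * 0ℚ
        ≡⟨ trans (*-zeroʳ (q ^ suc t)) (sym (*-zeroʳ c)) ⟩
      c * 0ℚ ∎)

  poch-aq-double : ∀ n → poch (a * q) q (n ℕ.+ n) ≡ poch (a * q) q n * Π (g n) n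
  poch-aq-double n = begin
    poch (a * q) q (n ℕ.+ n)          ≡⟨ poch≡Π (a * q) q (n ℕ.+ n) ⟩
    Π f (n ℕ.+ n)                     ≡⟨ Π-+ f n n ⟩
    Π f n * Πfrom f n n               ≡⟨ cong₂ _*_ (sym (poch≡Π (a * q) q n)) (Π-cong n shift) ⟩
    poch (a * q) q n * Π (g n) n      ∎
    where
    open ≡-Reasoning
    f : ℕ → ℚ
    f i = 1ℚ - a * q * q ^ i
    reassoc : ∀ a q x y → 1ℚ - a * q * (x * y) ≡ 1ℚ - a * q * x * y
    reassoc = solve-∀ ℚ-ring
    shift : ∀ i → f (n ℕ.+ i) ≡ g n i
    shift i = trans (cong (λ z → 1ℚ - a * q * z) (^-distribˡ-+-* q n i)) (reassoc a q (q ^ n) (q ^ i))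

  jackson-summation : ∀ b n → q ≢ 0ℚ → k ≢ 0ℚ → b * k ≡ a * q → W6ok a b (k * q ^ n) (inv q ^ n) q n →
    W6 a b (k * q ^ n) (inv q ^ n) q 1ℚ n * (poch k q n * Π (λ i → a - k * q ^ i) n * q ^ n)
      ≡ poch (a * q) q n * poch q q n * k ^ n
  jackson-summation b n q≢0 k≢0 bk≡aq ok@(1-a≢0 , b≢0 , _ , _ , dens≢0) = *-cancelˡ-≡ _ _ d≢0 (begin
    d * (W * denom n)                                    ≡⟨ sym (*-assoc d W (denom n)) ⟩
    d * W * denom n                                      ≡⟨ cong (_* denom n) (W6-rescaled b n q≢0 k≢0 bk≡aq ok) ⟩
    S n * denom n                                        ≡⟨ closed-form n q≢0 1-qqⁱ≢0 1-kqⁱ≢0 (kqⁿ-aqʲ≢0 n q≢0 k≢0 D≢0) n ℕ.≤-refl ⟩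
    (1ℚ - a) * poch (a * q) q (n ℕ.+ n) * Q * k ^ n      ≡⟨ cong (λ P → (1ℚ - a) * P * Q * k ^ n) (poch-aq-double n) ⟩
    (1ℚ - a) * (poch (a * q) q n * G) * Q * k ^ n        ≡⟨ regroup (1ℚ - a) (poch (a * q) q n) G Q (k ^ n) ⟩
    d * (poch (a * q) q n * Q * k ^ n)                   ∎)
    where
    open ≡-Reasoning
    W = W6 a b (k * q ^ n) (inv q ^ n) q 1ℚ n
    G = Π (g n) n
    Q = poch q q n
    d = (1ℚ - a) * G
    Q≢0 : Q ≢ 0ℚ
    Q≢0 = proj₁ (dens≢0 n ℕ.≤-refl)
    K≢0 : poch (a * q /' b) q n ≢ 0ℚ
    K≢0 = proj₁ (proj₂ (dens≢0 n ℕ.≤-refl))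
    D≢0 : poch (a * q /' (k * q ^ n)) q n ≢ 0ℚ
    D≢0 = proj₁ (proj₂ (proj₂ (dens≢0 n ℕ.≤-refl)))
    G≢0 : poch (a * q /' (inv q ^ n)) q n ≢ 0ℚ
    G≢0 = proj₂ (proj₂ (proj₂ (dens≢0 n ℕ.≤-refl)))
    d≢0 : d ≢ 0ℚ
    d≢0 = *-≢0 1-a≢0 (subst (_≢ 0ℚ) (poch-aqⁿ⁺¹ n n) G≢0)
    1-qqⁱ≢0 : ∀ i → i < n → 1ℚ - q * q ^ i ≢ 0ℚ
    1-qqⁱ≢0 = poch≢0⇒factor≢0 q q n Q≢0
    1-kqⁱ≢0 : ∀ i → i < n → 1ℚ - k * q ^ i ≢ 0ℚ
    1-kqⁱ≢0 = poch≢0⇒factor≢0 k q n (subst (_≢ 0ℚ) (poch-aq/b b n b≢0 bk≡aq) K≢0)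
    regroup : ∀ d P G Q K → d * (P * G) * Q * K ≡ d * G * (P * Q * K)
    regroup = solve-∀ ℚ-ring

-- The quadratic transformation

open Jackson using (jackson-summation)

Π[a-kqⁱ]≡ : ∀ n a k q → a ≢ 0ℚ → Π (λ i → a - k * q ^ i) n ≡ a ^ n * poch (k /' a) q n
Π[a-kqⁱ]≡ n a k q a≢0 = begin
  Π (λ i → a - k * q ^ i) n                          ≡⟨ sym (*-identityˡ _) ⟩
  1ℚ * Π (λ i → a - k * q ^ i) n                     ≡⟨ cong (_* Π (λ i → a - k * q ^ i) n) (sym aⁿa⁻ⁿ≡1) ⟩
  a ^ n * inv a ^ n * Π (λ i → a - k * q ^ i) n      ≡⟨ *-assoc (a ^ n) (inv a ^ n) _ ⟩
  a ^ n * (inv a ^ n * Π (λ i → a - k * q ^ i) n)    ≡⟨ cong (a ^ n *_) (sym (poch-rescale (inv a) a k q n (trans (*-comm (inv a) a) (p*inv[p]≡1 a≢0)))) ⟩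
  a ^ n * poch (inv a * k) q n                       ≡⟨ cong (λ z → a ^ n * poch z q n) (*-comm (inv a) k) ⟩
  a ^ n * poch (k /' a) q n                          ∎
  where
  open ≡-Reasoning
  aⁿa⁻ⁿ≡1 : a ^ n * inv a ^ n ≡ 1ℚ
  aⁿa⁻ⁿ≡1 = trans (sym (^-distribʳ-* a (inv a) n)) (trans (cong (_^ n) (p*inv[p]≡1 a≢0)) (1^n≡1 n))

Π[ak/q-k²q²ⁱ]≡ : ∀ n a k q → a ≢ 0ℚ → q ≢ 0ℚ →
  Π (λ i → a * k /' q - k * k * (q * q) ^ i) n * q ^ n ≡ k ^ n * a ^ n * poch (k * q /' a) (q * q) n
Π[ak/q-k²q²ⁱ]≡ n a k q a≢0 q≢0 = begin
  Π f n * q ^ n                                     ≡⟨ *-comm (Π f n) (q ^ n) ⟩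
  q ^ n * Π f n                                     ≡⟨ sym (Π-const-* q f n) ⟩
  Π (λ i → q * f i) n                               ≡⟨ Π-cong n factor ⟩
  Π (λ i → k * a * (1ℚ - k * q /' a * (q * q) ^ i)) n ≡⟨ Π-const-* (k * a) _ n ⟩
  (k * a) ^ n * Π (λ i → 1ℚ - k * q /' a * (q * q) ^ i) n
    ≡⟨ cong₂ _*_ (^-distribʳ-* k a n) (sym (poch≡Π (k * q /' a) (q * q) n)) ⟩
  k ^ n * a ^ n * poch (k * q /' a) (q * q) n       ∎
  where
  open ≡-Reasoning
  f : ℕ → ℚ
  f i = a * k /' q - k * k * (q * q) ^ i
  expandˡ : ∀ a k q iq u → q * (a * k * iq - k * k * u) ≡ a * k * (q * iq) - q * k * k * u
  expandˡ = solve-∀ ℚ-ring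
  expandʳ : ∀ a k q ia u → k * a * (1ℚ - k * q * ia * u) ≡ k * a - q * k * k * u * (a * ia)
  expandʳ = solve-∀ ℚ-ring
  reorder : ∀ a k q u → a * k * 1ℚ - q * k * k * u ≡ k * a - q * k * k * u * 1ℚ
  reorder = solve-∀ ℚ-ring
  factor : ∀ i → q * f i ≡ k * a * (1ℚ - k * q /' a * (q * q) ^ i)
  factor i = begin
    q * f i                                             ≡⟨ expandˡ a k q (inv q) ((q * q) ^ i) ⟩
    a * k * (q * inv q) - q * k * k * (q * q) ^ i       ≡⟨ cong (λ z → a * k * z - q * k * k * (q * q) ^ i) (p*inv[p]≡1 q≢0) ⟩
    a * k * 1ℚ - q * k * k * (q * q) ^ i                ≡⟨ reorder a k q ((q * q) ^ i) ⟩
    k * a - q * k * k * (q * q) ^ i * 1ℚ                ≡⟨ cong (λ z → k * a - q * k * k * (q * q) ^ i * z) (sym (p*inv[p]≡1 a≢0)) ⟩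
    k * a - q * k * k * (q * q) ^ i * (a * inv a)       ≡⟨ sym (expandʳ a k q (inv a) ((q * q) ^ i)) ⟩
    k * a * (1ℚ - k * q /' a * (q * q) ^ i)             ∎

jackson-summation-q : ∀ n a k q → a ≢ 0ℚ → k ≢ 0ℚ → q ≢ 0ℚ → W6ok a (a * q /' k) (k * q ^ n) (inv q ^ n) q n →
  W6 a (a * q /' k) (k * q ^ n) (inv q ^ n) q 1ℚ n * (poch k q n * (a ^ n * poch (k /' a) q n) * q ^ n)
    ≡ poch (a * q) q n * poch q q n * k ^ n
jackson-summation-q n a k q a≢0 k≢0 q≢0 ok =
  subst (λ P → W6 a (a * q /' k) (k * q ^ n) (inv q ^ n) q 1ℚ n * (poch k q n * P * q ^ n) ≡ poch (a * q) q n * poch q q n * k ^ n)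
        (Π[a-kqⁱ]≡ n a k q a≢0)
        (jackson-summation a k q (a * q /' k) n q≢0 k≢0 (x*inv[y]*y≡x (a * q) k≢0) ok)

jackson-summation-q² : ∀ n a k q → a ≢ 0ℚ → k ≢ 0ℚ → q ≢ 0ℚ →
  W6ok (a * k /' q) (a * q /' k) (k * k * q ^ (2 ℕ.* n)) (inv q ^ (2 ℕ.* n)) (q * q) n →
  W6 (a * k /' q) (a * q /' k) (k * k * q ^ (2 ℕ.* n)) (inv q ^ (2 ℕ.* n)) (q * q) 1ℚ n
    * (poch k q n * poch (- k) q n * (k ^ n * a ^ n * poch (k * q /' a) (q * q) n) * q ^ n)
    ≡ poch (a * k * q) (q * q) n * (poch q q n * poch (- q) q n) * (k ^ n * k ^ n)
jackson-summation-q² n a k q a≢0 k≢0 q≢0 ok = begin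
  W6 A b (k * k * q ^ (2 ℕ.* n)) (inv q ^ (2 ℕ.* n)) p 1ℚ n * (P₁ * P₂ * (k ^ n * a ^ n * P₇) * q ^ n)
    ≡⟨ cong₃ (λ u v U → W6 A b (k * k * u) v p 1ℚ n * U) q²ⁿ≡ q⁻²ⁿ≡ denominator≡ ⟩
  W6 A b (k * k * p ^ n) (inv p ^ n) p 1ℚ n * (poch (k * k) p n * Π (λ i → A - k * k * p ^ i) n * p ^ n)
    ≡⟨ jackson-summation A (k * k) p b n (*-≢0 q≢0 q≢0) (*-≢0 k≢0 k≢0) bk²≡Ap
         (subst₂ (λ u v → W6ok A b (k * k * u) v p n) q²ⁿ≡ q⁻²ⁿ≡ ok) ⟩
  poch (A * p) p n * poch p p n * (k * k) ^ n
    ≡⟨ cong₃ (λ u v w → poch u p n * v * w) Ap≡akq (poch-square q q n) (^-distribʳ-* k k n) ⟩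
  poch (a * k * q) p n * (poch q q n * poch (- q) q n) * (k ^ n * k ^ n) ∎
  where
  open ≡-Reasoning
  A = a * k /' q
  b = a * q /' k
  p = q * q
  P₁ = poch k q n
  P₂ = poch (- k) q n
  P₇ = poch (k * q /' a) p n
  Πₗ = Π (λ i → A - k * k * p ^ i) n
  2n≡n+n : 2 ℕ.* n ≡ n ℕ.+ n
  2n≡n+n = cong (n ℕ.+_) (ℕ.+-identityʳ n)
  q²ⁿ≡ : q ^ (2 ℕ.* n) ≡ p ^ n
  q²ⁿ≡ = trans (cong (q ^_) 2n≡n+n) (trans (^-distribˡ-+-* q n n) (sym (^-distribʳ-* q q n)))
  q⁻²ⁿ≡ : inv q ^ (2 ℕ.* n) ≡ inv p ^ n
  q⁻²ⁿ≡ = trans (cong (inv q ^_) 2n≡n+n) (trans (^-distribˡ-+-* (inv q) n n)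
            (trans (sym (^-distribʳ-* (inv q) (inv q) n)) (cong (_^ n) (sym (inv-distrib-* q q)))))
  regroup : ∀ P Π Q → P * (Π * Q) * Q ≡ P * Π * (Q * Q)
  regroup = solve-∀ ℚ-ring
  denominator≡ : P₁ * P₂ * (k ^ n * a ^ n * P₇) * q ^ n ≡ poch (k * k) p n * Πₗ * p ^ n
  denominator≡ = begin
    P₁ * P₂ * (k ^ n * a ^ n * P₇) * q ^ n   ≡⟨ cong (λ z → P₁ * P₂ * z * q ^ n) (sym (Π[ak/q-k²q²ⁱ]≡ n a k q a≢0 q≢0)) ⟩
    P₁ * P₂ * (Πₗ * q ^ n) * q ^ n           ≡⟨ regroup (P₁ * P₂) Πₗ (q ^ n) ⟩
    P₁ * P₂ * Πₗ * (q ^ n * q ^ n)           ≡⟨ cong₂ (λ u v → u * Πₗ * v) (sym (poch-square k q n)) (sym (^-distribʳ-* q q n)) ⟩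
    poch (k * k) p n * Πₗ * p ^ n            ∎
  Ap≡akq : A * p ≡ a * k * q
  Ap≡akq = trans (sym (*-assoc A q q)) (cong (_* q) (x*inv[y]*y≡x (a * k) q≢0))
  swap : ∀ u v w → u * v * w ≡ u * w * v
  swap = solve-∀ ℚ-ring
  bk²≡Ap : b * (k * k) ≡ A * p
  bk²≡Ap = begin
    b * (k * k)        ≡⟨ sym (*-assoc b k k) ⟩
    b * k * k          ≡⟨ cong (_* k) (x*inv[y]*y≡x (a * q) k≢0) ⟩
    a * q * k          ≡⟨ swap a q k ⟩
    a * k * q          ≡⟨ sym Ap≡akq ⟩
    A * p              ∎

quotient-of-summations : ∀ L R P₁ P₂ P₃ P₄ P₅ P₆ P₇ P₈ Kⁿ Aⁿ Qⁿ →
  L * (P₁ * P₂ * (Kⁿ * Aⁿ * P₇) * Qⁿ) ≡ P₆ * (P₃ * P₄) * (Kⁿ * Kⁿ) → R * (P₁ * (Aⁿ * P₈) * Qⁿ) ≡ P₅ * P₃ * Kⁿ →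
  P₁ * P₂ * (Kⁿ * Aⁿ * P₇) * Qⁿ ≢ 0ℚ → P₂ ≢ 0ℚ → P₅ ≢ 0ℚ → P₇ ≢ 0ℚ →
  L ≡ (P₈ * P₄) /' (P₂ * P₅) * (P₆ /' P₇) * R
quotient-of-summations L R P₁ P₂ P₃ P₄ P₅ P₆ P₇ P₈ Kⁿ Aⁿ Qⁿ L-sum R-sum u≢0 P₂≢0 P₅≢0 P₇≢0 =
  *-cancelʳ-≡ L (f * R) u≢0 (begin
    L * u                                ≡⟨ L-sum ⟩
    P₆ * (P₃ * P₄) * (Kⁿ * Kⁿ)           ≡⟨ sym numerators-match ⟩
    P₅ * P₃ * Kⁿ * c                     ≡⟨ cong (_* c) (sym R-sum) ⟩
    R * (P₁ * (Aⁿ * P₈) * Qⁿ) * c        ≡⟨ *-assoc R _ c ⟩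
    R * (P₁ * (Aⁿ * P₈) * Qⁿ * c)        ≡⟨ cong (R *_) (sym factors-match) ⟩
    R * (f * u)                          ≡⟨ regroup R f u ⟩
    f * R * u                            ∎)
  where
  open ≡-Reasoning
  u = P₁ * P₂ * (Kⁿ * Aⁿ * P₇) * Qⁿ
  f = (P₈ * P₄) /' (P₂ * P₅) * (P₆ /' P₇)
  c = P₄ * P₆ * Kⁿ * inv P₅
  regroup : ∀ R f u → R * (f * u) ≡ f * R * u
  regroup = solve-∀ ℚ-ring
  separate : ∀ P₁ P₂ P₄ P₆ P₇ P₈ i₂ i₅ i₇ Kⁿ Aⁿ Qⁿ →
    P₈ * P₄ * (i₂ * i₅) * (P₆ * i₇) * (P₁ * P₂ * (Kⁿ * Aⁿ * P₇) * Qⁿ)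
      ≡ P₁ * (Aⁿ * P₈) * Qⁿ * (P₄ * P₆ * Kⁿ * i₅) * ((P₂ * i₂) * (P₇ * i₇))
  separate = solve-∀ ℚ-ring
  factors-match : f * u ≡ P₁ * (Aⁿ * P₈) * Qⁿ * c
  factors-match = begin
    P₈ * P₄ * inv (P₂ * P₅) * (P₆ * inv P₇) * u
      ≡⟨ cong (λ z → P₈ * P₄ * z * (P₆ * inv P₇) * u) (inv-distrib-* P₂ P₅) ⟩
    P₈ * P₄ * (inv P₂ * inv P₅) * (P₆ * inv P₇) * u
      ≡⟨ separate P₁ P₂ P₄ P₆ P₇ P₈ (inv P₂) (inv P₅) (inv P₇) Kⁿ Aⁿ Qⁿ ⟩
    P₁ * (Aⁿ * P₈) * Qⁿ * c * ((P₂ * inv P₂) * (P₇ * inv P₇))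
      ≡⟨ cong (P₁ * (Aⁿ * P₈) * Qⁿ * c *_) (cong₂ _*_ (p*inv[p]≡1 P₂≢0) (p*inv[p]≡1 P₇≢0)) ⟩
    P₁ * (Aⁿ * P₈) * Qⁿ * c * (1ℚ * 1ℚ)
      ≡⟨ *-identityʳ _ ⟩
    P₁ * (Aⁿ * P₈) * Qⁿ * c ∎
  cancel-P₅ : ∀ P₃ P₄ P₅ P₆ Kⁿ i₅ → P₅ * P₃ * Kⁿ * (P₄ * P₆ * Kⁿ * i₅) ≡ P₆ * (P₃ * P₄) * (Kⁿ * Kⁿ) * (P₅ * i₅)
  cancel-P₅ = solve-∀ ℚ-ring
  numerators-match : P₅ * P₃ * Kⁿ * c ≡ P₆ * (P₃ * P₄) * (Kⁿ * Kⁿ)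
  numerators-match = trans (cancel-P₅ P₃ P₄ P₅ P₆ Kⁿ (inv P₅))
    (trans (cong (P₆ * (P₃ * P₄) * (Kⁿ * Kⁿ) *_) (p*inv[p]≡1 P₅≢0)) (*-identityʳ _))

mainTheorem16 : (n : ℕ) (a k q : ℚ) →
    a ≢ 0ℚ → k ≢ 0ℚ → q ≢ 0ℚ →
    W6ok (a * k /' q) (a * q /' k) (k * k * q ^ (2 Data.Nat.* n)) (inv q ^ (2 Data.Nat.* n)) (q * q) n →
    W6ok a (a * q /' k) (k * q ^ n) (inv q ^ n) q n →
    poch (- k) q n ≢ 0ℚ → poch (a * q) q n ≢ 0ℚ → poch (k * q /' a) (q * q) n ≢ 0ℚ →
    W6 (a * k /' q) (a * q /' k) (k * k * q ^ (2 Data.Nat.* n)) (inv q ^ (2 Data.Nat.* n)) (q * q) 1ℚ n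
    ≡ ((poch (k /' a) q n * poch (- q) q n) /' (poch (- k) q n * poch (a * q) q n))
      * (poch (a * k * q) (q * q) n /' poch (k * q /' a) (q * q) n)
      * W6 a (a * q /' k) (k * q ^ n) (inv q ^ n) q 1ℚ n
mainTheorem16 n a k q a≢0 k≢0 q≢0 okL okR@(_ , b≢0 , _ , _ , dens≢0) ⟨-k⟩ₙ≢0 ⟨aq⟩ₙ≢0 ⟨kq/a⟩ₙ≢0 =
  quotient-of-summations _ _ (poch k q n) (poch (- k) q n) (poch q q n) (poch (- q) q n) (poch (a * q) q n)
    (poch (a * k * q) (q * q) n) (poch (k * q /' a) (q * q) n) (poch (k /' a) q n) (k ^ n) (a ^ n) (q ^ n)
    (jackson-summation-q² n a k q a≢0 k≢0 q≢0 okL) (jackson-summation-q n a k q a≢0 k≢0 q≢0 okR)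
    (*-≢0 (*-≢0 (*-≢0 ⟨k⟩ₙ≢0 ⟨-k⟩ₙ≢0) (*-≢0 (*-≢0 (^-≢0 n k≢0) (^-≢0 n a≢0)) ⟨kq/a⟩ₙ≢0)) (^-≢0 n q≢0))
    ⟨-k⟩ₙ≢0 ⟨aq⟩ₙ≢0 ⟨kq/a⟩ₙ≢0
  where
  ⟨k⟩ₙ≢0 : poch k q n ≢ 0ℚ
  ⟨k⟩ₙ≢0 = subst (_≢ 0ℚ) (Jackson.poch-aq/b a k q (a * q /' k) n b≢0 (x*inv[y]*y≡x (a * q) k≢0))
                  (proj₁ (proj₂ (dens≢0 n ℕ.≤-refl)))
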